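{- Let $K\subseteq\mathbb{Z}_{\ge2}$ and let $G$ be a set of positive integers. Suppose there exists a $K$-GDD on $v$ points with all group sizes in $G$, and for each $g\in G$ there exists a PBD$(g+1,K)$. Then there exists a PBD$(v+1,K)$. Furthermore, if the $K$-GDD has strong dimension $d$, then there exists such a PBD$(v+1,K)$ of dimension at least $d$.
   Context: A PBD$(v,K)$ is a pair $(X,\mathcal{B})$ with $|X|=v$ and blocks $B\subseteq X$, $|B|\in K$, such that any two distinct points lie in exactly one block; a subspace is a subset $X'$ such that every block meeting $X'$ in at least two points lies in $X'$, proper if $X'\ne X$; the subspace generated by a set is the intersection of all subspaces containing it; the dimension is the maximum $d$ such that every $d$ points generate a proper subspace. A $K$-GDD is a triple $(X,\Pi,\mathcal{B})$ with $\Pi$ a partition of $X$ into groups and $\mathcal{B}$ a set of blocks with sizes in $K$ such that a group and a block meet in at most one point and any two points in distinct groups lie in exactly one block. A strong subspace of a GDD is a subset $X'\subseteq X$ such that each group is contained in or disjoint from $X'$ and every block meeting $X'$ in at least two points is contained in $X'$; it is proper if it is disjoint from at least one group. The strong dimension of a GDD is the maximum $d$ such that every set of $d$ points is contained in a proper strong subspace. -}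

module Defs where

open import Level using (0ℓ)
open import Data.Nat using (ℕ; suc; _≤_; _<_)
open import Data.Fin using (Fin)
open import Data.Fin.Subset using (Subset; _∈_; _∉_; _⊆_; ∣_∣; Nonempty)
open import Data.Product using (Σ; Σ-syntax; _×_)
open import Data.Sum using (_⊎_)
open import Relation.Unary using (Pred)
open import Relation.Nullary using (¬_)
open import Relation.Binary.PropositionalEquality using (_≡_; _≢_)

record PBD (v : ℕ) (K : Pred ℕ 0ℓ) : Set where
  field
    nb        : ℕ
    block     : Fin nb → Subset v
    blockSize : ∀ i → K ∣ block i ∣
    balanced  : ∀ (x y : Fin v) → x ≢ y →
                Σ[ i ∈ Fin nb ] (x ∈ block i × y ∈ block i ×
                  (∀ j → x ∈ block j → y ∈ block j → j ≡ i))

module _ {v : ℕ} {K : Pred ℕ 0ℓ} (P : PBD v K) where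
  open PBD P

  IsSubspace : Subset v → Set
  IsSubspace S = ∀ i (x y : Fin v) → x ≢ y →
    x ∈ block i → x ∈ S → y ∈ block i → y ∈ S → block i ⊆ S

  InGenerated : Subset v → Fin v → Set
  InGenerated T x = ∀ (S : Subset v) → IsSubspace S → T ⊆ S → x ∈ S

  GeneratesProper : Subset v → Set
  GeneratesProper T = Σ[ x ∈ Fin v ] ¬ InGenerated T x

  DimProperty : ℕ → Set
  DimProperty d = ∀ (T : Subset v) → ∣ T ∣ ≡ d → GeneratesProper T

  HasDimension : ℕ → Set
  HasDimension d = d ≤ v × DimProperty d ×
    (∀ d' → d < d' → d' ≤ v → ¬ DimProperty d')

record GDD (v : ℕ) (K : Pred ℕ 0ℓ) : Set where
  field
    ng        : ℕ
    group     : Fin ng → Subset v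
    groupNonempty : ∀ g → Nonempty (group g)
    partition : ∀ (x : Fin v) →
                Σ[ g ∈ Fin ng ] (x ∈ group g × (∀ h → x ∈ group h → h ≡ g))
    nb        : ℕ
    block     : Fin nb → Subset v
    blockSize : ∀ i → K ∣ block i ∣
    meetOnce  : ∀ i g (x y : Fin v) → x ∈ block i → x ∈ group g →
                y ∈ block i → y ∈ group g → x ≡ y
    balanced  : ∀ (x y : Fin v) → (∀ g → x ∈ group g → y ∉ group g) →
                Σ[ i ∈ Fin nb ] (x ∈ block i × y ∈ block i ×
                  (∀ j → x ∈ block j → y ∈ block j → j ≡ i))

module _ {v : ℕ} {K : Pred ℕ 0ℓ} (D : GDD v K) where
  open GDD D

  DisjointFrom : Subset v → Subset v → Set
  DisjointFrom A S = ∀ x → x ∈ A → x ∉ S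

  IsStrongSubspace : Subset v → Set
  IsStrongSubspace S =
    (∀ g → group g ⊆ S ⊎ DisjointFrom (group g) S) ×
    (∀ i (x y : Fin v) → x ≢ y →
      x ∈ block i → x ∈ S → y ∈ block i → y ∈ S → block i ⊆ S)

  IsProperStrong : Subset v → Set
  IsProperStrong S = Σ[ g ∈ Fin ng ] DisjointFrom (group g) S

  StrongDimProperty : ℕ → Set
  StrongDimProperty d = ∀ (T : Subset v) → ∣ T ∣ ≡ d →
    Σ[ S ∈ Subset v ] (IsStrongSubspace S × IsProperStrong S × T ⊆ S)

  HasStrongDimension : ℕ → Set
  HasStrongDimension d = d ≤ v × StrongDimProperty d ×
    (∀ d' → d < d' → d' ≤ v → ¬ StrongDimProperty d')

-- Adjoin a new point ∞ to the groups of the GDD and place on each group g,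
-- together with ∞, a copy of a PBD(|g| + 1, K).  Two points of a common group
-- (or a point and ∞) then lie in exactly one block of that copy, and two points
-- of distinct groups in exactly one block of the GDD.  A proper strong subspace S
-- of the GDD yields the subspace S ∪ {∞}, which misses the points of a group
-- disjoint from S; hence every d points generate a proper subspace whenever the
-- GDD has strong dimension d.  Having this property is decidable, so the largest
-- such d, the dimension, exists and is at least d.
module Submission where

open import Defs
open import Level using (0ℓ)
open import Data.Nat using (ℕ; suc; _≤_)
open import Data.Fin using (Fin)
open import Data.Fin.Subset using (∣_∣)
open import Data.Product using (Σ; Σ-syntax; _×_)
open import Relation.Unary using (Pred)

open import Data.Nat using (zero; _+_; _<_; z≤n; s≤s; _≟_; _≤?_)
open import Data.Nat.Properties
  using (≤-refl; ≤-antisym; ≰⇒>; <⇒≱; n≤0⇒n≡0; m≤n⇒m≤1+n; m≤n⇒m<n∨m≡n)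
open import Data.Fin using (zero; suc)
open import Data.Fin.Properties using (+↔⊎; all?; any?; suc-injective) renaming (_≟_ to _≟ᶠ_)
open import Data.Fin.Subset using (Subset; inside; outside; _∈_; _∉_; _⊆_)
open import Data.Fin.Subset.Properties
  using (drop-there; out⊆; in⊆in; ∣p∣≤∣x∷p∣; _∈?_; _⊆?_; anySubset?)
open import Data.Vec using ([]; _∷_; here; there)
open import Data.Vec.Functional using (foldr)
open import Data.Product using (_,_; ∃; ∃-syntax)
open import Data.Sum using (_⊎_; inj₁; inj₂)
open import Data.Sum.Function.Propositional using (_⊎-↔_)
open import Data.Empty using (⊥-elim)
open import Function using (_∘_; id; _↔_; mk↔ₛ′; Inverse)
open import Function.Properties.Inverse using (↔-refl; ↔-trans; ↔-sym)
open import Relation.Nullary using (¬_; Dec; yes; no; ¬?)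
open import Relation.Nullary.Decidable using (map′; _→-dec_; decidable-stable)
open import Relation.Binary.PropositionalEquality using (_≡_; _≢_; refl; sym; trans; cong; subst)

private
  variable
    n : ℕ

embed : (S : Subset n) → Fin ∣ S ∣ → Fin n
embed (inside ∷ S) zero = zero
embed (inside ∷ S) (suc k) = suc (embed S k)
embed (outside ∷ S) k = suc (embed S k)

embed-∈ : ∀ (S : Subset n) k → embed S k ∈ S
embed-∈ (inside ∷ S) zero = here
embed-∈ (inside ∷ S) (suc k) = there (embed-∈ S k)
embed-∈ (outside ∷ S) k = there (embed-∈ S k)

embed-injective : ∀ (S : Subset n) {k l} → embed S k ≡ embed S l → k ≡ l
embed-injective (inside ∷ S) {zero} {zero} _ = refl
embed-injective (inside ∷ S) {suc k} {suc l} e = cong suc (embed-injective S (suc-injective e))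
embed-injective (outside ∷ S) e = embed-injective S (suc-injective e)

embed-surjective : ∀ (S : Subset n) {x} → x ∈ S → ∃[ k ] embed S k ≡ x
embed-surjective (inside ∷ S) here = zero , refl
embed-surjective (inside ∷ S) (there x∈S) with embed-surjective S x∈S
... | k , refl = suc k , refl
embed-surjective (outside ∷ S) (there x∈S) with embed-surjective S x∈S
... | k , refl = k , refl

embedSubset : (S : Subset n) → Subset ∣ S ∣ → Subset n
embedSubset [] [] = []
embedSubset (inside ∷ S) (b ∷ B) = b ∷ embedSubset S B
embedSubset (outside ∷ S) B = outside ∷ embedSubset S B

embedSubset-∈⁺ : ∀ (S : Subset n) B {k} → k ∈ B → embed S k ∈ embedSubset S B
embedSubset-∈⁺ (inside ∷ S) (b ∷ B) here = here
embedSubset-∈⁺ (inside ∷ S) (b ∷ B) (there k∈B) = there (embedSubset-∈⁺ S B k∈B)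
embedSubset-∈⁺ (outside ∷ S) B k∈B = there (embedSubset-∈⁺ S B k∈B)

embedSubset-∈⁻ : ∀ (S : Subset n) B k → embed S k ∈ embedSubset S B → k ∈ B
embedSubset-∈⁻ (inside ∷ S) (b ∷ B) zero here = here
embedSubset-∈⁻ (inside ∷ S) (b ∷ B) (suc k) (there p) = there (embedSubset-∈⁻ S B k p)
embedSubset-∈⁻ (outside ∷ S) B k (there p) = embedSubset-∈⁻ S B k p

embedSubset-⊆ : ∀ (S : Subset n) B → embedSubset S B ⊆ S
embedSubset-⊆ (inside ∷ S) (b ∷ B) here = here
embedSubset-⊆ (inside ∷ S) (b ∷ B) (there p) = there (embedSubset-⊆ S B p)
embedSubset-⊆ (outside ∷ S) B (there p) = there (embedSubset-⊆ S B p)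

∣embedSubset∣ : ∀ (S : Subset n) B → ∣ embedSubset S B ∣ ≡ ∣ B ∣
∣embedSubset∣ [] [] = refl
∣embedSubset∣ (inside ∷ S) (inside ∷ B) = cong suc (∣embedSubset∣ S B)
∣embedSubset∣ (inside ∷ S) (outside ∷ B) = ∣embedSubset∣ S B
∣embedSubset∣ (outside ∷ S) B = ∣embedSubset∣ S B

extendToSize : ∀ {m d} (T : Subset m) → ∣ T ∣ ≤ d → d ≤ m →
  ∃[ T′ ] (T ⊆ T′ × ∣ T′ ∣ ≡ d)
extendToSize [] z≤n z≤n = [] , id , refl
extendToSize (inside ∷ T) (s≤s ∣T∣≤d) (s≤s d≤m) with extendToSize T ∣T∣≤d d≤m
... | T′ , T⊆T′ , refl = inside ∷ T′ , in⊆in T⊆T′ , refl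
extendToSize {d = zero} (outside ∷ T) ∣T∣≤0 _ = outside ∷ T , id , n≤0⇒n≡0 ∣T∣≤0
extendToSize {d = suc d} (outside ∷ T) ∣T∣≤1+d (s≤s d≤m) with ∣ T ∣ ≤? d
... | no ∣T∣≰d = outside ∷ T , id , ≤-antisym ∣T∣≤1+d (≰⇒> ∣T∣≰d)
... | yes ∣T∣≤d with extendToSize T ∣T∣≤d d≤m
...   | T′ , T⊆T′ , refl = inside ∷ T′ , out⊆ T⊆T′ , refl

∷⊆inside∷ : ∀ t {p q : Subset n} → p ⊆ q → t ∷ p ⊆ inside ∷ q
∷⊆inside∷ inside = in⊆in
∷⊆inside∷ outside = out⊆

∑ : (Fin n → ℕ) → ℕ
∑ = foldr _+_ 0

Σ-Fin-suc↔ : {P : Fin (suc n) → Set} → Σ (Fin (suc n)) P ↔ (P zero ⊎ Σ (Fin n) (P ∘ suc))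
Σ-Fin-suc↔ = mk↔ₛ′ to from to∘from from∘to
  where
  to : Σ _ _ → _ ⊎ _
  to (zero , p) = inj₁ p
  to (suc i , p) = inj₂ (i , p)
  from : _ ⊎ _ → Σ _ _
  from (inj₁ p) = zero , p
  from (inj₂ (i , p)) = suc i , p
  to∘from : ∀ q → to (from q) ≡ q
  to∘from (inj₁ p) = refl
  to∘from (inj₂ (i , p)) = refl
  from∘to : ∀ q → from (to q) ≡ q
  from∘to (zero , p) = refl
  from∘to (suc i , p) = refl

Fin-∑↔Σ : (f : Fin n → ℕ) → Fin (∑ f) ↔ Σ (Fin n) (Fin ∘ f)
Fin-∑↔Σ {zero} f = mk↔ₛ′ (λ ()) (λ ()) (λ ()) (λ ())
Fin-∑↔Σ {suc n} f =
  ↔-trans +↔⊎ (↔-trans (↔-refl ⊎-↔ Fin-∑↔Σ (f ∘ suc)) (↔-sym Σ-Fin-suc↔))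

module _ {I : Set} (B : I → Subset n) where

  UniqueBlock : Fin n → Fin n → I → Set
  UniqueBlock x y i = x ∈ B i × y ∈ B i × (∀ j → x ∈ B j → y ∈ B j → j ≡ i)

  ClosedUnder : Subset n → Set
  ClosedUnder S = ∀ i (x y : Fin n) → x ≢ y →
    x ∈ B i → x ∈ S → y ∈ B i → y ∈ S → B i ⊆ S

module _ {K : Pred ℕ 0ℓ} {m : ℕ} {I : Set} (e : Fin m ↔ I) (B : I → Subset n)
         (B-size : ∀ i → K ∣ B i ∣)
         (B-balanced : ∀ x y → x ≢ y → ∃ (UniqueBlock B x y)) where
  open Inverse e

  reindexPBD : PBD n K
  reindexPBD = record
    { nb = m
    ; block = B ∘ to
    ; blockSize = B-size ∘ to
    ; balanced = λ x y x≢y → reindex (B-balanced x y x≢y)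
    }
    where
    reindex : ∀ {x y} → ∃ (UniqueBlock B x y) → ∃ (UniqueBlock (B ∘ to) x y)
    reindex {x} {y} (i , x∈ , y∈ , unique) =
      from i ,
      subst (λ i → x ∈ B i) (sym (strictlyInverseˡ i)) x∈ ,
      subst (λ i → y ∈ B i) (sym (strictlyInverseˡ i)) y∈ ,
      λ j x∈j y∈j → trans (sym (strictlyInverseʳ j)) (cong from (unique (to j) x∈j y∈j))

-- The new point ∞ is zero : Fin (suc v); a point x of the GDD becomes suc x.
module Filling {v : ℕ} {K : Pred ℕ 0ℓ} (D : GDD v K)
  (Q : (g : Fin (GDD.ng D)) → PBD ∣ inside ∷ GDD.group D g ∣ K) where
  open GDD D

  extGroup : Fin ng → Subset (suc v)
  extGroup g = inside ∷ group g

  Index : Set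
  Index = Fin nb ⊎ Σ[ g ∈ Fin ng ] Fin (PBD.nb (Q g))

  Index↔ : Fin (nb + ∑ (PBD.nb ∘ Q)) ↔ Index
  Index↔ = ↔-trans +↔⊎ (↔-refl ⊎-↔ Fin-∑↔Σ (PBD.nb ∘ Q))

  fillBlock : Index → Subset (suc v)
  fillBlock (inj₁ a) = outside ∷ block a
  fillBlock (inj₂ (g , k)) = embedSubset (extGroup g) (PBD.block (Q g) k)

  fillBlock-size : ∀ i → K ∣ fillBlock i ∣
  fillBlock-size (inj₁ a) = blockSize a
  fillBlock-size (inj₂ (g , k)) =
    subst K (sym (∣embedSubset∣ (extGroup g) (PBD.block (Q g) k))) (PBD.blockSize (Q g) k)

  group-unique : ∀ {g h x} → x ∈ group g → x ∈ group h → h ≡ g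
  group-unique {g} {h} {x} x∈g x∈h with partition x
  ... | _ , _ , unique = trans (unique h x∈h) (sym (unique g x∈g))

  extGroup-unique : ∀ {g h x y} → x ≢ y → x ∈ extGroup g → y ∈ extGroup g →
    x ∈ extGroup h → y ∈ extGroup h → h ≡ g
  extGroup-unique {x = zero} {zero} x≢y _ _ _ _ = ⊥-elim (x≢y refl)
  extGroup-unique {x = suc x} _ (there x∈g) _ (there x∈h) _ = group-unique x∈g x∈h
  extGroup-unique {x = zero} {suc y} _ _ (there y∈g) _ (there y∈h) = group-unique y∈g y∈h

  block-meets-extGroup-once : ∀ {a g x y} → x ≢ y → x ∈ extGroup g → y ∈ extGroup g →
    x ∈ fillBlock (inj₁ a) → y ∈ fillBlock (inj₁ a) → x ≡ y
  block-meets-extGroup-once {a} {g} _ (there x∈g) (there y∈g) (there x∈a) (there y∈a) =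
    cong suc (meetOnce a g _ _ x∈a x∈g y∈a y∈g)

  fillBlock-⊆-extGroup : ∀ g k → fillBlock (inj₂ (g , k)) ⊆ extGroup g
  fillBlock-⊆-extGroup g k = embedSubset-⊆ (extGroup g) (PBD.block (Q g) k)

  balanced-inGroup : ∀ g {x y} → x ≢ y → x ∈ extGroup g → y ∈ extGroup g →
    ∃ (UniqueBlock fillBlock x y)
  balanced-inGroup g {x} {y} x≢y x∈g y∈g
    with embed-surjective (extGroup g) x∈g | embed-surjective (extGroup g) y∈g
  ... | kx , refl | ky , refl
    with PBD.balanced (Q g) kx ky (x≢y ∘ cong (embed (extGroup g)))
  ... | k , kx∈k , ky∈k , unique =
    inj₂ (g , k) ,
    embedSubset-∈⁺ (extGroup g) _ kx∈k , embedSubset-∈⁺ (extGroup g) _ ky∈k , unique′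
    where
    unique′ : ∀ i → x ∈ fillBlock i → y ∈ fillBlock i → i ≡ inj₂ (g , k)
    unique′ (inj₁ a) x∈a y∈a =
      ⊥-elim (x≢y (block-meets-extGroup-once x≢y x∈g y∈g x∈a y∈a))
    unique′ (inj₂ (h , l)) x∈l y∈l
      with extGroup-unique x≢y x∈g y∈g
             (fillBlock-⊆-extGroup h l x∈l) (fillBlock-⊆-extGroup h l y∈l)
    ... | refl = cong (λ l → inj₂ (g , l))
      (unique l (embedSubset-∈⁻ (extGroup g) _ kx x∈l) (embedSubset-∈⁻ (extGroup g) _ ky y∈l))

  balanced-acrossGroups : ∀ {x y} → (∀ g → x ∈ group g → y ∉ group g) →
    ∃ (UniqueBlock fillBlock (suc x) (suc y))
  balanced-acrossGroups {x} {y} apart with balanced x y apart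
  ... | a , x∈a , y∈a , unique = inj₁ a , there x∈a , there y∈a , unique′
    where
    unique′ : ∀ i → suc x ∈ fillBlock i → suc y ∈ fillBlock i → i ≡ inj₁ a
    unique′ (inj₁ b) (there x∈b) (there y∈b) = cong inj₁ (unique b x∈b y∈b)
    unique′ (inj₂ (g , k)) x∈k y∈k
      with fillBlock-⊆-extGroup g k x∈k | fillBlock-⊆-extGroup g k y∈k
    ... | there x∈g | there y∈g = ⊥-elim (apart g x∈g y∈g)

  fillBalanced : ∀ x y → x ≢ y → ∃ (UniqueBlock fillBlock x y)
  fillBalanced zero zero x≢y = ⊥-elim (x≢y refl)
  fillBalanced zero (suc y) x≢y with partition y
  ... | g , y∈g , _ = balanced-inGroup g x≢y here (there y∈g)
  fillBalanced (suc x) zero x≢y with partition x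
  ... | g , x∈g , _ = balanced-inGroup g x≢y (there x∈g) here
  fillBalanced (suc x) (suc y) x≢y with partition x
  ... | g , x∈g , _ with y ∈? group g
  ...   | yes y∈g = balanced-inGroup g x≢y (there x∈g) (there y∈g)
  ...   | no y∉g = balanced-acrossGroups λ h x∈h y∈h →
            y∉g (subst (λ h → y ∈ group h) (group-unique x∈g x∈h) y∈h)

  filled : PBD (suc v) K
  filled = reindexPBD Index↔ fillBlock fillBlock-size fillBalanced

  disjoint-extGroup : ∀ {g S x} → DisjointFrom D (group g) S →
    x ∈ extGroup g → x ∈ inside ∷ S → x ≡ zero
  disjoint-extGroup _ here _ = refl
  disjoint-extGroup disjoint (there x∈g) (there x∈S) = ⊥-elim (disjoint _ x∈g x∈S)

  strong⇒closed : ∀ {S} → IsStrongSubspace D S → ClosedUnder fillBlock (inside ∷ S)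
  strong⇒closed (_ , closed) (inj₁ a) (suc x) (suc y) x≢y (there x∈a) (there x∈S) (there y∈a) (there y∈S) =
    out⊆ (closed a x y (x≢y ∘ cong suc) x∈a x∈S y∈a y∈S)
  strong⇒closed (groupwise , _) (inj₂ (g , k)) x y x≢y x∈k x∈S y∈k y∈S with groupwise g
  ... | inj₁ g⊆S = in⊆in g⊆S ∘ fillBlock-⊆-extGroup g k
  ... | inj₂ disjoint = ⊥-elim (x≢y (trans
          (disjoint-extGroup disjoint (fillBlock-⊆-extGroup g k x∈k) x∈S)
          (sym (disjoint-extGroup disjoint (fillBlock-⊆-extGroup g k y∈k) y∈S))))

  strong⇒subspace : ∀ {S} → IsStrongSubspace D S → IsSubspace filled (inside ∷ S)
  strong⇒subspace strong = strong⇒closed strong ∘ Inverse.to Index↔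

  -- Dropping ∞ from a d-set and padding it back to d points of the GDD.
  strongDim⇒dim : ∀ {d} → d ≤ v → StrongDimProperty D d → DimProperty filled d
  strongDim⇒dim d≤v strongDim (t ∷ T) refl
    with extendToSize T (∣p∣≤∣x∷p∣ t T) d≤v
  ... | T′ , T⊆T′ , ∣T′∣≡d with strongDim T′ ∣T′∣≡d
  ... | S , strong , (g , disjoint) , T′⊆S with groupNonempty g
  ... | x , x∈g = suc x , λ generated → disjoint x x∈g
          (drop-there (generated (inside ∷ S) (strong⇒subspace strong) (∷⊆inside∷ t (T′⊆S ∘ T⊆T′))))

allSubsets? : {P : Pred (Subset n) 0ℓ} → (∀ S → Dec (P S)) → Dec (∀ S → P S)
allSubsets? P? =
  map′ (λ noCounterexample S → decidable-stable (P? S) (λ ¬PS → noCounterexample (S , ¬PS)))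
       (λ all (S , ¬PS) → ¬PS (all S))
       (¬? (anySubset? (¬? ∘ P?)))

IsGreatestUpTo : ℕ → Pred ℕ 0ℓ → ℕ → Set
IsGreatestUpTo M P d = d ≤ M × P d × (∀ e → d < e → e ≤ M → ¬ P e)

module _ {P : Pred ℕ 0ℓ} where

  isGreatestUpTo-self : ∀ {M} → P M → IsGreatestUpTo M P M
  isGreatestUpTo-self PM = ≤-refl , PM , λ e M<e e≤M → ⊥-elim (<⇒≱ M<e e≤M)

  isGreatestUpTo-suc : ∀ {M d} → ¬ P (suc M) → IsGreatestUpTo M P d → IsGreatestUpTo (suc M) P d
  isGreatestUpTo-suc {M} ¬P[1+M] (d≤M , Pd , greatest) = m≤n⇒m≤1+n d≤M , Pd , greatest′
    where
    greatest′ : ∀ e → _ < e → e ≤ suc M → ¬ P e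
    greatest′ e d<e e≤1+M with m≤n⇒m<n∨m≡n e≤1+M
    ... | inj₁ (s≤s e≤M) = greatest e d<e e≤M
    ... | inj₂ refl = ¬P[1+M]

  greatestUpTo : (∀ d → Dec (P d)) → ∀ {d M} → d ≤ M → P d → ∃[ d′ ] (IsGreatestUpTo M P d′ × d ≤ d′)
  greatestUpTo P? {M = zero} z≤n Pd = zero , isGreatestUpTo-self Pd , z≤n
  greatestUpTo P? {M = suc M} d≤1+M Pd with P? (suc M) | m≤n⇒m<n∨m≡n d≤1+M
  ... | yes P[1+M] | _ = suc M , isGreatestUpTo-self P[1+M] , d≤1+M
  ... | no ¬P[1+M] | inj₂ refl = ⊥-elim (¬P[1+M] Pd)
  ... | no ¬P[1+M] | inj₁ (s≤s d≤M) with greatestUpTo P? d≤M Pd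
  ...   | d′ , isGreatest , d≤d′ = d′ , isGreatestUpTo-suc ¬P[1+M] isGreatest , d≤d′

module _ {K : Pred ℕ 0ℓ} (P : PBD n K) where
  open PBD P

  isSubspace? : ∀ S → Dec (IsSubspace P S)
  isSubspace? S = all? λ i → all? λ x → all? λ y →
    ¬? (x ≟ᶠ y) →-dec (x ∈? block i) →-dec (x ∈? S) →-dec
    (y ∈? block i) →-dec (y ∈? S) →-dec (block i ⊆? S)

  inGenerated? : ∀ T x → Dec (InGenerated P T x)
  inGenerated? T x = allSubsets? λ S → isSubspace? S →-dec (T ⊆? S) →-dec (x ∈? S)

  dimProperty? : ∀ d → Dec (DimProperty P d)
  dimProperty? d = allSubsets? λ T → (∣ T ∣ ≟ d) →-dec any? (λ x → ¬? (inGenerated? T x))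

  dimension-≥ : ∀ {d} → d ≤ n → DimProperty P d → ∃[ d′ ] (HasDimension P d′ × d ≤ d′)
  dimension-≥ = greatestUpTo dimProperty?

mainTheorem5 : (K G : Pred ℕ 0ℓ) (v : ℕ) →
    (∀ k → K k → 2 ≤ k) →
    (∀ g → G g → 1 ≤ g) →
    (D : GDD v K) →
    (∀ (j : Fin (GDD.ng D)) → G ∣ GDD.group D j ∣) →
    (∀ g → G g → PBD (suc g) K) →
    PBD (suc v) K ×
    (∀ d → HasStrongDimension D d →
      Σ[ P ∈ PBD (suc v) K ] Σ[ d' ∈ ℕ ] (HasDimension P d' × d ≤ d'))
mainTheorem5 K G v _ _ D groupSizes pbd =
  filled , λ d (d≤v , strongDim , _) →
    filled , dimension-≥ filled (m≤n⇒m≤1+n d≤v) (strongDim⇒dim d≤v strongDim)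
  where
  open Filling D (λ g → pbd ∣ GDD.group D g ∣ (groupSizes g))
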